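{- Assume $b>1$ and $y\in\mathbb{Z}_p$ is $q$-full. Let $i\in\{1,\dots,b\}$ and let $n$ be a positive integer. Then $$p\,d_i(n)>\sum_{k=0}^{\infty}y_i\bigl(n-k(p-1)\bigr).$$
   Context: $p$ is a prime, $q=p^b$. Every $y\in\mathbb{Z}_p$ is written uniquely as $y=\sum_{i=1}^b p^{i-1}y_i$ with $y_i=\sum_{j\ge0}y_{i,j}q^j$, $0\le y_{i,j}<p$. $y$ is $q$-full if no $y_i$ is a non-negative integer. For $n\ge1$, $d_i(n)=p^{i-1}q^{w}$ with $w\ge0$ the unique integer such that $\sum_{j=0}^{w-1}y_{i,j}<n\le\sum_{j=0}^{w}y_{i,j}$; for $m\in\mathbb{Z}$, $y_i(m)=\sum_{n=1}^m d_i(n)$ (zero for $m\le0$, so the sum in the claim is finite). -}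

module Defs where

open import Data.Nat using (ℕ; zero; suc; _+_; _*_; _∸_; _^_; _≤_; _<_)
open import Data.List using (List; map; upTo)
open import Data.Nat.ListAction using (sum)
open import Data.Product using (∃; _×_)
open import Relation.Nullary using (¬_)
open import Relation.Binary.PropositionalEquality using (_≡_; _≢_)

-- An element y of ℤ_p is represented by its base-p digit sequence
-- y = Σ_k a k * p^k with 0 ≤ a k < p.  Regrouping by residues of k mod b
-- (q = p^b) gives y = Σ_{i=1}^b p^{i-1} y_i with y_i = Σ_j y_{i,j} q^j and
-- y_{i,j} = a ((i-1) + b*j).

Σ< : ℕ → (ℕ → ℕ) → ℕ
Σ< m f = sum (map f (upTo m))

digit : (b : ℕ) → (ℕ → ℕ) → ℕ → ℕ → ℕ
digit b y i j = y ((i ∸ 1) + b * j)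

-- y_i is a non-negative integer: its q-adic digits are eventually zero
IsNatComponent : (b : ℕ) → (ℕ → ℕ) → ℕ → Set
IsNatComponent b y i = ∃ λ N → ∀ j → N ≤ j → digit b y i j ≡ 0

QFull : (b : ℕ) → (ℕ → ℕ) → Set
QFull b y = ∀ i → 1 ≤ i → i ≤ b → ¬ IsNatComponent b y i

S : (b : ℕ) → (ℕ → ℕ) → ℕ → ℕ → ℕ
S b y i v = Σ< v (digit b y i)

IsExpo : (b : ℕ) → (ℕ → ℕ) → ℕ → (ℕ → ℕ) → Set
IsExpo b y i w = ∀ n → 1 ≤ n → (S b y i (w n) < n) × (n ≤ S b y i (suc (w n)))

dfun : (p b i : ℕ) → (ℕ → ℕ) → ℕ → ℕ
dfun p b i w n = p ^ (i ∸ 1) * (p ^ b) ^ (w n)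

-- y_i(m) = Σ_{n=1}^{m} d_i(n)   (for m ≤ 0 this is 0; negative arguments are
-- represented by truncated subtraction giving 0)
yfun : (p b i : ℕ) → (ℕ → ℕ) → ℕ → ℕ
yfun p b i w m = Σ< m (λ t → dfun p b i w (suc t))

-- Σ_{k ≥ 0} y_i(n - k(p-1)): terms with k ≥ n vanish since p - 1 ≥ 1,
-- so summing k over 0,…,n suffices.
tailSum : (p b i : ℕ) → (ℕ → ℕ) → ℕ → ℕ
tailSum p b i w n = Σ< (suc n) (λ k → yfun p b i w (n ∸ k * (p ∸ 1)))

module Submission where

open import Defs
open import Data.Nat
  using (ℕ; zero; suc; pred; NonZero; >-nonZero⁻¹; _+_; _*_; _∸_; _^_; _≤_; _<_; z≤n; s≤s; _≤?_)
open import Data.Nat.Properties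
open import Data.Nat.Primality using (Prime; ¬prime[0]; ¬prime[1])
open import Data.Nat.Induction using (<-rec)
open import Data.Nat.ListAction using (sum)
open import Data.Nat.ListAction.Properties using (sum-++)
open import Data.Nat.Tactic.RingSolver using (solve)
open import Data.List using ([]; _∷_; [_]; map; upTo; applyUpTo; _++_)
open import Data.List.Properties using (map-upTo; map-cong; applyUpTo-∷ʳ)
open import Data.Product using (proj₁; proj₂)
open import Data.Sum using (inj₁; inj₂)
open import Data.Empty using (⊥-elim)
open import Function using (_∘_)
open import Relation.Nullary using (yes; no)
open import Relation.Binary.PropositionalEquality
  using (_≡_; refl; sym; trans; cong; cong₂; subst; module ≡-Reasoning)

-- Write r = p − 1 and q = p^b = s + 1.  Since every digit is at most r, the
-- exponent w increases by at least one whenever n increases by r, so along the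
-- chain n, n − r, n − 2r, … the values d_i decay at least geometrically with
-- ratio 1/q.  Hence y_i(n) ≤ r q/(q−1) · d_i(n), and summing once more over the
-- chain, Σ_k y_i(n − k r) ≤ r q²/(q−1)² · d_i(n).  Finally r q² < p (q−1)²
-- as soon as q ≥ 2p, which holds because b ≥ 2.

Σ<-suc : ∀ n f → Σ< (suc n) f ≡ Σ< n f + f n
Σ<-suc n f = begin
  sum (map f (upTo (suc n)))       ≡⟨ cong sum (map-upTo f (suc n)) ⟩
  sum (applyUpTo f (suc n))        ≡⟨ cong sum (applyUpTo-∷ʳ f n) ⟨
  sum (applyUpTo f n ++ [ f n ])   ≡⟨ sum-++ (applyUpTo f n) [ f n ] ⟩
  sum (applyUpTo f n) + (f n + 0)  ≡⟨ cong₂ _+_ (sym (cong sum (map-upTo f n))) (+-identityʳ (f n)) ⟩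
  Σ< n f + f n                     ∎
  where open ≡-Reasoning

Σ<-suc′ : ∀ n f → Σ< (suc n) f ≡ f 0 + Σ< n (f ∘ suc)
Σ<-suc′ n f = trans (cong sum (map-upTo f (suc n)))
                    (cong (f 0 +_) (sym (cong sum (map-upTo (f ∘ suc) n))))

Σ<-cong : ∀ n {f g} → (∀ k → f k ≡ g k) → Σ< n f ≡ Σ< n g
Σ<-cong n f≗g = cong sum (map-cong f≗g (upTo n))

Σ<-monoˡ-≤ : ∀ f {m n} → m ≤ n → Σ< m f ≤ Σ< n f
Σ<-monoˡ-≤ f {n = zero} z≤n = ≤-refl
Σ<-monoˡ-≤ f {m} {suc n} m≤1+n with m≤n⇒m<n∨m≡n m≤1+n
... | inj₁ m<1+n = begin
  Σ< m f        ≤⟨ Σ<-monoˡ-≤ f (≤-pred m<1+n) ⟩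
  Σ< n f        ≤⟨ m≤m+n (Σ< n f) (f n) ⟩
  Σ< n f + f n  ≡⟨ Σ<-suc n f ⟨
  Σ< (suc n) f  ∎
  where open ≤-Reasoning
... | inj₂ refl = ≤-refl

Σ<-≤-support : ∀ {m} n f → (∀ k → m ≤ k → f k ≡ 0) → Σ< n f ≤ Σ< m f
Σ<-≤-support zero f _ = z≤n
Σ<-≤-support {m} (suc n) f f≡0 with m ≤? n
... | no m≰n = Σ<-monoˡ-≤ f (≰⇒> m≰n)
... | yes m≤n = begin
  Σ< (suc n) f  ≡⟨ Σ<-suc n f ⟩
  Σ< n f + f n  ≡⟨ cong (Σ< n f +_) (f≡0 n m≤n) ⟩
  Σ< n f + 0    ≡⟨ +-identityʳ (Σ< n f) ⟩
  Σ< n f        ≤⟨ Σ<-≤-support n f f≡0 ⟩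
  Σ< m f        ∎
  where open ≤-Reasoning

Σ<-≤-∸ : ∀ j n f {B} → (∀ t → t < n → f t ≤ B) → Σ< n f ≤ j * B + Σ< (n ∸ j) f
Σ<-≤-∸ j       zero    f _   = z≤n
Σ<-≤-∸ zero    (suc n) f _   = ≤-refl
Σ<-≤-∸ (suc j) (suc n) f {B} f≤B = begin
  Σ< (suc n) f                    ≡⟨ Σ<-suc n f ⟩
  Σ< n f + f n                    ≤⟨ +-mono-≤ (Σ<-≤-∸ j n f (λ t t<n → f≤B t (m<n⇒m<1+n t<n)))
                                              (f≤B n ≤-refl) ⟩
  (j * B + Σ< (n ∸ j) f) + B      ≡⟨ trans (+-comm _ B) (sym (+-assoc B (j * B) _)) ⟩
  suc j * B + Σ< (n ∸ j) f        ∎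
  where open ≤-Reasoning

∸≡suc⇒+≤ : ∀ n r {m} → n ∸ r ≡ suc m → suc m + r ≤ n
∸≡suc⇒+≤ n       zero    refl = ≤-reflexive (+-identityʳ n)
∸≡suc⇒+≤ (suc n) (suc r) eq   = subst (_≤ suc n) (sym (+-suc _ r)) (s≤s (∸≡suc⇒+≤ n r eq))

-- tailSum p b i w is definitionally chainSum (p ∸ 1) (yfun p b i w).  By
-- truncated subtraction, the terms with k r ≥ n are all g 0.
chainSum : ℕ → (ℕ → ℕ) → ℕ → ℕ
chainSum r g n = Σ< (suc n) (λ k → g (n ∸ k * r))

chainSum-step : ∀ r .{{_ : NonZero r}} g → g 0 ≡ 0 →
                ∀ n → chainSum r g n ≤ g n + chainSum r g (n ∸ r)
chainSum-step r g g0≡0 n = begin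
  chainSum r g n                             ≡⟨ Σ<-suc′ n _ ⟩
  g n + Σ< n (λ k → g (n ∸ (r + k * r)))     ≡⟨ cong (g n +_) (Σ<-cong n (λ k → cong g (∸-+-assoc n r (k * r)))) ⟨
  g n + Σ< n (λ k → g (n ∸ r ∸ k * r))       ≤⟨ +-monoʳ-≤ (g n) (Σ<-≤-support n _ vanishes) ⟩
  g n + chainSum r g (n ∸ r)                 ∎
  where
  open ≤-Reasoning
  vanishes : ∀ k → suc (n ∸ r) ≤ k → g (n ∸ r ∸ k * r) ≡ 0
  vanishes k n∸r<k = trans (cong g (m≤n⇒m∸n≡0 (≤-trans (<⇒≤ n∸r<k) (m≤m*n k r)))) g0≡0

module GeometricChain (r s : ℕ) .{{_ : NonZero r}} (D : ℕ → ℕ)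
  (D-gap : ∀ {m n} → 1 ≤ m → m + r ≤ n → suc s * D m ≤ D n) where

  chain-bound : ∀ (F E : ℕ → ℕ) a c → F 0 ≡ 0 → (∀ n → F n ≤ E n + F (n ∸ r)) →
                (∀ n → a * E n ≤ c * D n) → ∀ n → s * (a * F n) ≤ suc s * (c * D n)
  chain-bound F E a c F0≡0 F-step E-bound = <-rec Bound bound
    where
    open ≤-Reasoning

    Bound : ℕ → Set
    Bound n = s * (a * F n) ≤ suc s * (c * D n)

    previous : ∀ n → (∀ {m} → m < n → Bound m) → s * (a * F (n ∸ r)) ≤ c * D n
    previous n rec with n ∸ r in eq
    ... | zero rewrite F0≡0 | *-zeroʳ a | *-zeroʳ s = z≤n
    ... | suc m = begin
      s * (a * F (suc m))      ≤⟨ rec (<-≤-trans (m<m+n (suc m) (>-nonZero⁻¹ r)) 1+m+r≤n) ⟩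
      suc s * (c * D (suc m))  ≡⟨ swap (suc s) c (D (suc m)) ⟩
      c * (suc s * D (suc m))  ≤⟨ *-monoʳ-≤ c (D-gap (s≤s z≤n) 1+m+r≤n) ⟩
      c * D n                  ∎
      where
      1+m+r≤n : suc m + r ≤ n
      1+m+r≤n = ∸≡suc⇒+≤ n r eq
      swap : ∀ x y z → x * (y * z) ≡ y * (x * z)
      swap x y z = solve (x ∷ y ∷ z ∷ [])

    bound : ∀ n → (∀ {m} → m < n → Bound m) → Bound n
    bound n rec = begin
      s * (a * F n)                        ≤⟨ *-monoʳ-≤ s (*-monoʳ-≤ a (F-step n)) ⟩
      s * (a * (E n + F (n ∸ r)))          ≡⟨ trans (cong (s *_) (*-distribˡ-+ a _ _)) (*-distribˡ-+ s _ _) ⟩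
      s * (a * E n) + s * (a * F (n ∸ r))  ≤⟨ +-mono-≤ (*-monoʳ-≤ s (E-bound n)) (previous n rec) ⟩
      s * (c * D n) + c * D n              ≡⟨ +-comm (s * (c * D n)) (c * D n) ⟩
      suc s * (c * D n)                    ∎

module Exponent (b i : ℕ) (y w : ℕ → ℕ) (expo : IsExpo b y i w) where
  open ≤-Reasoning

  expo-mono : ∀ {m n} → 1 ≤ m → m ≤ n → w m ≤ w n
  expo-mono {m} {n} 1≤m m≤n = ≮⇒≥ λ wn<wm → <-irrefl refl (begin-strict
    S b y i (w m)        <⟨ proj₁ (expo m 1≤m) ⟩
    m                    ≤⟨ m≤n ⟩
    n                    ≤⟨ proj₂ (expo n (≤-trans 1≤m m≤n)) ⟩
    S b y i (suc (w n))  ≤⟨ Σ<-monoˡ-≤ (digit b y i) wn<wm ⟩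
    S b y i (w m)        ∎)

  expo-gap : ∀ {r m n} → (∀ j → digit b y i j ≤ r) → 1 ≤ m → m + r ≤ n → w m < w n
  expo-gap {r} {m} {n} digit≤r 1≤m m+r≤n = ≰⇒> λ wn≤wm → <-irrefl refl (begin-strict
    m + r                              ≤⟨ m+r≤n ⟩
    n                                  ≤⟨ proj₂ (expo n 1≤n) ⟩
    S b y i (suc (w n))                ≡⟨ Σ<-suc (w n) (digit b y i) ⟩
    S b y i (w n) + digit b y i (w n)  ≤⟨ +-mono-≤ (Σ<-monoˡ-≤ (digit b y i) wn≤wm) (digit≤r (w n)) ⟩
    S b y i (w m) + r                  <⟨ +-monoˡ-< r (proj₁ (expo m 1≤m)) ⟩
    m + r                              ∎)
    where
    1≤n : 1 ≤ n
    1≤n = ≤-trans 1≤m (≤-trans (m≤m+n m r) m+r≤n)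

module _ (p : ℕ) .{{_ : NonZero p}} (b i : ℕ) (w : ℕ → ℕ) where

  dfun-nonZero : ∀ n → NonZero (dfun p b i w n)
  dfun-nonZero n = m*n≢0 (p ^ (i ∸ 1)) ((p ^ b) ^ w n) {{m^n≢0 p (i ∸ 1)}} {{m^n≢0 (p ^ b) (w n) {{m^n≢0 p b}}}}

  dfun-mono : ∀ {m n} → w m ≤ w n → dfun p b i w m ≤ dfun p b i w n
  dfun-mono wm≤wn = *-monoʳ-≤ (p ^ (i ∸ 1)) (^-monoʳ-≤ (p ^ b) {{m^n≢0 p b}} wm≤wn)

  dfun-step : ∀ {m n} → w m < w n → p ^ b * dfun p b i w m ≤ dfun p b i w n
  dfun-step {m} wm<wn = begin
    p ^ b * (p ^ (i ∸ 1) * (p ^ b) ^ w m)  ≡⟨ swap (p ^ b) (p ^ (i ∸ 1)) ((p ^ b) ^ w m) ⟩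
    p ^ (i ∸ 1) * (p ^ b) ^ suc (w m)      ≤⟨ *-monoʳ-≤ (p ^ (i ∸ 1)) (^-monoʳ-≤ (p ^ b) {{m^n≢0 p b}} wm<wn) ⟩
    dfun p b i w _                         ∎
    where
    open ≤-Reasoning
    swap : ∀ x y z → x * (y * z) ≡ y * (x * z)
    swap x y z = solve (x ∷ y ∷ z ∷ [])

module TailSumBound (r b i : ℕ) .{{_ : NonZero r}} (y w : ℕ → ℕ) (expo : IsExpo b y i w)
  (digit≤r : ∀ j → digit b y i j ≤ r) (s : ℕ) (q≡1+s : suc r ^ b ≡ suc s) where

  open Exponent b i y w expo

  private
    D : ℕ → ℕ
    D = dfun (suc r) b i w

    Y : ℕ → ℕ
    Y = yfun (suc r) b i w

    D-gap : ∀ {m n} → 1 ≤ m → m + r ≤ n → suc s * D m ≤ D n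
    D-gap {m} {n} 1≤m m+r≤n = subst (λ q → q * D m ≤ D n) q≡1+s
                                (dfun-step (suc r) b i w (expo-gap digit≤r 1≤m m+r≤n))

    Y-step : ∀ n → Y n ≤ r * D n + Y (n ∸ r)
    Y-step n = Σ<-≤-∸ r n (D ∘ suc) (λ t t<n → dfun-mono (suc r) b i w (expo-mono (s≤s z≤n) t<n))

  open GeometricChain r s D D-gap

  yfun-bound : ∀ n → s * Y n ≤ suc s * r * D n
  yfun-bound n = begin
    s * Y n                ≡⟨ cong (s *_) (*-identityˡ (Y n)) ⟨
    s * (1 * Y n)          ≤⟨ chain-bound Y (λ m → r * D m) 1 r refl Y-step (λ m → ≤-reflexive (*-identityˡ (r * D m))) n ⟩
    suc s * (r * D n)      ≡⟨ *-assoc (suc s) r (D n) ⟨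
    suc s * r * D n        ∎
    where open ≤-Reasoning

  tailSum-bound : ∀ n → s * (s * tailSum (suc r) b i w n) ≤ suc s * (suc s * r * D n)
  tailSum-bound = chain-bound (chainSum r Y) Y s (suc s * r) refl (chainSum-step r Y refl) yfun-bound

2+2r≤[1+r]^b : ∀ r b → 1 ≤ r → 2 ≤ b → 2 + (r + r) ≤ suc r ^ b
2+2r≤[1+r]^b r b 1≤r 2≤b = begin
  2 + (r + r)             ≡⟨ +-comm 1 (1 + (r + r)) ⟩
  1 + (r + r) + 1         ≤⟨ +-monoʳ-≤ (1 + (r + r)) (*-mono-≤ 1≤r 1≤r) ⟩
  1 + (r + r) + r * r     ≡⟨ solve (r ∷ []) ⟩
  suc r * (suc r * 1)     ≤⟨ ^-monoʳ-≤ (suc r) 2≤b ⟩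
  suc r ^ b               ∎
  where open ≤-Reasoning

r[1+s]²<[1+r]s² : ∀ r s → suc (r + r) ≤ s → r * (suc s * suc s) < suc r * (s * s)
r[1+s]²<[1+r]s² r s 2r<s = begin-strict
  r * (suc s * suc s)            ≡⟨ solve (r ∷ s ∷ []) ⟩
  r * (s * s) + (s * (r + r) + r)  <⟨ +-monoʳ-< (r * (s * s)) (+-monoʳ-< (s * (r + r)) r<s) ⟩
  r * (s * s) + (s * (r + r) + s)  ≡⟨ cong (r * (s * s) +_) (solve (r ∷ s ∷ [])) ⟩
  r * (s * s) + suc (r + r) * s  ≤⟨ +-monoʳ-≤ (r * (s * s)) (*-monoˡ-≤ s 2r<s) ⟩
  r * (s * s) + s * s            ≡⟨ +-comm (r * (s * s)) (s * s) ⟩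
  suc r * (s * s)                ∎
  where
  open ≤-Reasoning
  r<s : r < s
  r<s = ≤-trans (s≤s (m≤m+n r r)) 2r<s

s²-bound⇒< : ∀ r s t d .{{_ : NonZero d}} → suc (r + r) ≤ s →
             s * (s * t) ≤ suc s * (suc s * r * d) → t < suc r * d
s²-bound⇒< r s t d 2r<s bound = *-cancelˡ-< (s * s) t (suc r * d) (begin-strict
  s * s * t                ≡⟨ *-assoc s s t ⟩
  s * (s * t)              ≤⟨ bound ⟩
  suc s * (suc s * r * d)  ≡⟨ solve (r ∷ s ∷ d ∷ []) ⟩
  r * (suc s * suc s) * d  <⟨ *-monoˡ-< d (r[1+s]²<[1+r]s² r s 2r<s) ⟩
  suc r * (s * s) * d      ≡⟨ solve (r ∷ s ∷ d ∷ []) ⟩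
  s * s * (suc r * d)      ∎)
  where open ≤-Reasoning

lemma6p6 : (p b : ℕ) → Prime p → 1 < b →
           (y : ℕ → ℕ) → (∀ k → y k < p) → QFull b y →
           (i : ℕ) → 1 ≤ i → i ≤ b →
           (w : ℕ → ℕ) → IsExpo b y i w →
           (n : ℕ) → 1 ≤ n →
           tailSum p b i w n < p * dfun p b i w n
lemma6p6 zero          _ p-prime = ⊥-elim (¬prime[0] p-prime)
lemma6p6 (suc zero)    _ p-prime = ⊥-elim (¬prime[1] p-prime)
lemma6p6 (suc r@(suc _)) b _ 1<b y y<p _ i _ _ w expo n _ =
  s²-bound⇒< r s _ _ {{dfun-nonZero (suc r) b i w n}} 2r<s (tailSum-bound n)
  where
  s : ℕ
  s = pred (suc r ^ b)
  q≡1+s : suc r ^ b ≡ suc s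
  q≡1+s = sym (suc-pred (suc r ^ b) {{m^n≢0 (suc r) b}})
  2r<s : suc (r + r) ≤ s
  2r<s = ≤-pred (subst (2 + (r + r) ≤_) q≡1+s (2+2r≤[1+r]^b r b (s≤s z≤n) 1<b))
  open TailSumBound r b i y w expo (λ j → ≤-pred (y<p _)) s q≡1+s
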